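{- The function $\mathsf{CtoB} : \mathsf{Cnf} \to \mathsf{Brw}$ is injective: for all $a,b : \mathsf{Cnf}$, $\mathsf{CtoB}(a) = \mathsf{CtoB}(b)$ implies $a = b$.
   Context: Cantor normal forms: $\mathcal{T}$ is the inductive type of binary trees with constructors $0$ and $\mathsf{node}(a,b)$; $<$ on $\mathcal{T}$ is generated by $0 < \mathsf{node}(a,b)$, $a < c \to \mathsf{node}(a,b) < \mathsf{node}(c,d)$, $b < d \to \mathsf{node}(a,b) < \mathsf{node}(a,d)$; $s \leq t := (s<t) \uplus (s=t)$; $\mathsf{left}(0):=0$, $\mathsf{left}(\mathsf{node}(a,b)) := a$; $\mathsf{isCNF}$ is generated by $\mathsf{isCNF}(0)$ and $\mathsf{isCNF}(s)\to\mathsf{isCNF}(t)\to \mathsf{left}(t)\leq s \to \mathsf{isCNF}(\mathsf{node}(s,t))$; $\mathsf{Cnf} := \Sigma(t:\mathcal{T}).\mathsf{isCNF}(t)$. Brouwer trees (in homotopy type theory): $\mathsf{Brw}$ is the quotient inductive-inductive type defined simultaneously with $\leq\, : \mathsf{Brw}\to\mathsf{Brw}\to\mathsf{hProp}$, $x<y := \mathsf{succ}\,x \leq y$; $\mathbb{N}\to_<\mathsf{Brw}$ is the type of sequences with $f(k)<f(k+1)$; constructors $\mathsf{zero}$, $\mathsf{succ}$, $\mathsf{limit} : (\mathbb{N}\to_<\mathsf{Brw})\to\mathsf{Brw}$, $\mathsf{bisim}$ identifying $\mathsf{limit}\,f$ and $\mathsf{limit}\,g$ whenever $\forall k\exists n.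 f(k)\leq g(n)$ and $\forall k \exists n. g(k)\leq f(n)$, and set truncation; $\leq$ has constructors $\mathsf{zero}\leq x$, transitivity, $x\leq y\to\mathsf{succ}\,x\leq\mathsf{succ}\,y$, $x\leq f(k)\to x\leq\mathsf{limit}\,f$, $(\forall k. f(k)\leq x)\to \mathsf{limit}\,f\leq x$, and propositional truncation. Arithmetic on $\mathsf{Brw}$: $x+\mathsf{zero}:=x$, $x+\mathsf{succ}\,y := \mathsf{succ}(x+y)$, $x+\mathsf{limit}\,f := \mathsf{limit}(\lambda k. x+f(k))$; $\iota(0):=\mathsf{zero}$, $\iota(n+1):=\mathsf{succ}\,\iota(n)$, $\omega:=\mathsf{limit}\,\iota$; $x\cdot\mathsf{zero}:=\mathsf{zero}$, $x\cdot\mathsf{succ}\,y:=x\cdot y+x$, $x\cdot\mathsf{limit}\,f := \mathsf{zero}$ if $x=\mathsf{zero}$, else $\mathsf{limit}(\lambda k. x\cdot f(k))$; $\omega^{\mathsf{zero}}:=\mathsf{succ}\,\mathsf{zero}$, $\omega^{\mathsf{succ}\,y}:=\omega^y\cdot\omega$, $\omega^{\mathsf{limit}\,f}:=\mathsf{limit}(\lambda k.\omega^{f(k)})$. $\mathsf{CtoB}(0) := \mathsf{zero}$, $\mathsf{CtoB}(\mathsf{node}(a,b)) := \omega^{\mathsf{CtoB}(a)} + \mathsf{CtoB}(b)$. -}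

module Defs where

open import Data.Nat as ℕ using (ℕ)
open import Data.Product using (Σ; Σ-syntax; _×_; _,_; proj₁; proj₂)
open import Data.Sum using (_⊎_; inj₁; inj₂)
open import Relation.Binary.PropositionalEquality using (_≡_)

data 𝒯 : Set where
  0T   : 𝒯
  node : 𝒯 → 𝒯 → 𝒯

infix 4 _<T_ _≤T_

data _<T_ : 𝒯 → 𝒯 → Set where
  <₁ : ∀ {a b} → 0T <T node a b
  <₂ : ∀ {a b c d} → a <T c → node a b <T node c d
  <₃ : ∀ {a b d} → b <T d → node a b <T node a d

_≤T_ : 𝒯 → 𝒯 → Set
s ≤T t = (s <T t) ⊎ (s ≡ t)

left : 𝒯 → 𝒯
left 0T = 0T
left (node a b) = a

data isCNF : 𝒯 → Set where
  cnf0    : isCNF 0T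
  cnfnode : ∀ {s t} → isCNF s → isCNF t → left t ≤T s → isCNF (node s t)

Cnf : Set
Cnf = Σ 𝒯 isCNF

-- The quotient inductive-inductive type of the paper is rendered as a
-- setoid: the underlying inductive-inductive type of "raw" trees (without
-- the path constructors 'bisim' and set truncation, and with '≤' not
-- truncated), together with the equality _≈_ that the quotient imposes,
-- i.e. the least congruence generated by 'bisim'.

infix 4 _≤_ _<_ _≈_

data Brw : Set
data _≤_ : Brw → Brw → Set

data Brw where
  zero  : Brw
  succ  : Brw → Brw
  limit : (f : ℕ → Brw) → {f↑ : (k : ℕ) → succ (f k) ≤ f (ℕ.suc k)} → Brw

data _≤_ where
  ≤-zero      : ∀ {x} → zero ≤ x
  ≤-trans     : ∀ {x y z} → x ≤ y → y ≤ z → x ≤ z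
  ≤-succ-mono : ∀ {x y} → x ≤ y → succ x ≤ succ y
  ≤-cocone    : ∀ {x} f {f↑} k → x ≤ f k → x ≤ limit f {f↑}
  ≤-limiting  : ∀ f {f↑} {x} → ((k : ℕ) → f k ≤ x) → limit f {f↑} ≤ x

_<_ : Brw → Brw → Set
x < y = succ x ≤ y

_≲_ : (ℕ → Brw) → (ℕ → Brw) → Set
f ≲ g = (k : ℕ) → Σ[ n ∈ ℕ ] (f k ≤ g n)

-- Equality of Brouwer trees: the equivalence relation generated by the
-- path constructor 'bisim' (congruence for succ; congruence for limit is
-- an instance of bisim).
data _≈_ : Brw → Brw → Set where
  ≈-refl  : ∀ {x} → x ≈ x
  ≈-sym   : ∀ {x y} → x ≈ y → y ≈ x
  ≈-trans : ∀ {x y z} → x ≈ y → y ≈ z → x ≈ z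
  ≈-succ  : ∀ {x y} → x ≈ y → succ x ≈ succ y
  bisim   : ∀ f {f↑} g {g↑} → f ≲ g → g ≲ f → limit f {f↑} ≈ limit g {g↑}

≤-refl : ∀ x → x ≤ x
≤-refl zero = ≤-zero
≤-refl (succ x) = ≤-succ-mono (≤-refl x)
≤-refl (limit f) = ≤-limiting f (λ k → ≤-cocone f k (≤-refl (f k)))

≤-succ-incr : ∀ x → x ≤ succ x
≤-succ-incr zero = ≤-zero
≤-succ-incr (succ x) = ≤-succ-mono (≤-succ-incr x)
≤-succ-incr (limit f) =
  ≤-limiting f (λ k → ≤-trans (≤-succ-incr (f k))
                               (≤-succ-mono (≤-cocone f k (≤-refl (f k)))))

infixl 6 _+_
infixl 7 _·_

_+_ : Brw → Brw → Brw
+-mono : ∀ {x y z} → y ≤ z → x + y ≤ x + z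
x≤x+y : ∀ x y → x ≤ x + y

x + zero = x
x + succ y = succ (x + y)
x + limit f {f↑} = limit (λ k → x + f k) {λ k → +-mono (f↑ k)}

+-mono {x} (≤-zero {z}) = x≤x+y x z
+-mono (≤-trans p q) = ≤-trans (+-mono p) (+-mono q)
+-mono (≤-succ-mono p) = ≤-succ-mono (+-mono p)
+-mono {x} (≤-cocone f {f↑} k p) =
  ≤-cocone (λ k → x + f k) {λ k → +-mono (f↑ k)} k (+-mono p)
+-mono {x} (≤-limiting f {f↑} h) =
  ≤-limiting (λ k → x + f k) {λ k → +-mono (f↑ k)} (λ k → +-mono (h k))

x≤x+y x zero = ≤-refl x
x≤x+y x (succ y) = ≤-trans (x≤x+y x y) (≤-succ-incr (x + y))
x≤x+y x (limit f {f↑}) =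
  ≤-cocone (λ k → x + f k) {λ k → +-mono (f↑ k)} 0 (x≤x+y x (f 0))

+-mono-left : ∀ {a b} c → a ≤ b → a + c ≤ b + c
+-mono-left zero p = p
+-mono-left (succ c) p = ≤-succ-mono (+-mono-left c p)
+-mono-left {a} {b} (limit f {f↑}) p =
  ≤-limiting (λ k → a + f k) {λ k → +-mono (f↑ k)}
    (λ k → ≤-cocone (λ k → b + f k) {λ k → +-mono (f↑ k)} k (+-mono-left (f k) p))

x≤0+x : ∀ x → x ≤ zero + x
x≤0+x zero = ≤-zero
x≤0+x (succ x) = ≤-succ-mono (x≤0+x x)
x≤0+x (limit f {f↑}) =
  ≤-limiting f (λ k → ≤-cocone (λ k → zero + f k) {λ k → +-mono (f↑ k)} k (x≤0+x (f k)))

<+pos : ∀ y {x} → succ zero ≤ x → succ y ≤ y + x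
<+pos y p = +-mono {y} p

ι : ℕ → Brw
ι ℕ.zero = zero
ι (ℕ.suc n) = succ (ι n)

ω : Brw
ω = limit ι {λ k → ≤-refl (succ (ι k))}

-- Multiplication.  x · limit f := zero if x = zero, else limit (x · f k).
-- (A raw tree is equal to zero exactly when it is syntactically zero.)

_·_ : Brw → Brw → Brw
·-mono : ∀ x {y z} → y ≤ z → x · y ≤ x · z
·-pos< : ∀ x → succ zero ≤ x → ∀ {a b} → succ a ≤ b → succ (x · a) ≤ x · b
·-below-lim : ∀ x f {f↑} k → x · f k ≤ x · limit f {f↑}
0·≤0 : ∀ y → zero · y ≤ zero

x · zero = zero
x · succ y = x · y + x
zero · limit f = zero
succ x · limit f {f↑} =
  limit (λ k → succ x · f k) {λ k → ·-pos< (succ x) (≤-succ-mono ≤-zero) (f↑ k)}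
limit g {g↑} · limit f {f↑} =
  limit (λ k → limit g {g↑} · f k)
    {λ k → ·-pos< (limit g {g↑})
             (≤-cocone g {g↑} 1 (≤-trans (≤-succ-mono ≤-zero) (g↑ 0))) (f↑ k)}

·-pos< x pos {a} p = ≤-trans (<+pos (x · a) pos) (·-mono x p)

·-below-lim zero f k = 0·≤0 (f k)
·-below-lim (succ x) f {f↑} k =
  ≤-cocone (λ k → succ x · f k) {λ k → ·-pos< (succ x) (≤-succ-mono ≤-zero) (f↑ k)} k
    (≤-refl (succ x · f k))
·-below-lim (limit g {g↑}) f {f↑} k =
  ≤-cocone (λ k → limit g {g↑} · f k)
    {λ k → ·-pos< (limit g {g↑})
             (≤-cocone g {g↑} 1 (≤-trans (≤-succ-mono ≤-zero) (g↑ 0))) (f↑ k)} k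
    (≤-refl (limit g {g↑} · f k))

0·≤0 zero = ≤-zero
0·≤0 (succ y) = 0·≤0 y
0·≤0 (limit f) = ≤-zero

·-mono x ≤-zero = ≤-zero
·-mono x (≤-trans p q) = ≤-trans (·-mono x p) (·-mono x q)
·-mono x (≤-succ-mono p) = +-mono-left x (·-mono x p)
·-mono x (≤-cocone f k p) = ≤-trans (·-mono x p) (·-below-lim x f k)
·-mono zero (≤-limiting f h) = ≤-zero
·-mono (succ x) (≤-limiting f {f↑} h) =
  ≤-limiting (λ k → succ x · f k) {λ k → ·-pos< (succ x) (≤-succ-mono ≤-zero) (f↑ k)}
    (λ k → ·-mono (succ x) (h k))
·-mono (limit g {g↑}) (≤-limiting f {f↑} h) =
  ≤-limiting (λ k → limit g {g↑} · f k)
    {λ k → ·-pos< (limit g {g↑})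
             (≤-cocone g {g↑} 1 (≤-trans (≤-succ-mono ≤-zero) (g↑ 0))) (f↑ k)}
    (λ k → ·-mono (limit g {g↑}) (h k))

<·ω : ∀ x → succ zero ≤ x → succ x ≤ x · ω
<·ω x pos =
  ≤-trans (+-mono {x} pos)
   (≤-trans (+-mono-left x (x≤0+x x)) (·-below-lim x ι 2))

ω^ : Brw → Brw
ω^-mono : ∀ {y z} → y ≤ z → ω^ y ≤ ω^ z
ω^-pos : ∀ y → succ zero ≤ ω^ y

ω^ zero = succ zero
ω^ (succ y) = ω^ y · ω
ω^ (limit f {f↑}) =
  limit (λ k → ω^ (f k))
    {λ k → ≤-trans (<·ω (ω^ (f k)) (ω^-pos (f k))) (ω^-mono (f↑ k))}

ω^-pos zero = ≤-refl (succ zero)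
ω^-pos (succ y) =
  ≤-trans (ω^-pos y) (≤-trans (≤-succ-incr (ω^ y)) (<·ω (ω^ y) (ω^-pos y)))
ω^-pos (limit f {f↑}) =
  ≤-cocone (λ k → ω^ (f k))
    {λ k → ≤-trans (<·ω (ω^ (f k)) (ω^-pos (f k))) (ω^-mono (f↑ k))} 0 (ω^-pos (f 0))

ω^-mono {z = z} ≤-zero = ω^-pos z
ω^-mono (≤-trans p q) = ≤-trans (ω^-mono p) (ω^-mono q)
ω^-mono {succ y} {succ z} (≤-succ-mono p) = ·ω-mono (ω^-mono p)
  where
  ι-mono : ∀ k → ω^ y · ι k ≤ ω^ z · ι k
  ι-mono ℕ.zero = ≤-zero
  ι-mono (ℕ.suc k) = ≤-trans (+-mono-left (ω^ y) (ι-mono k)) (+-mono (ω^-mono p))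
  ·ω-mono : ω^ y ≤ ω^ z → ω^ y · ω ≤ ω^ z · ω
  ·ω-mono _ = lim-le (ω^ y) (λ k → ≤-trans (ι-mono k) (·-below-lim (ω^ z) ι k))
    where
    lim-le : ∀ a → (∀ k → a · ι k ≤ ω^ z · ω) → a · ω ≤ ω^ z · ω
    lim-le zero h = ≤-zero
    lim-le (succ a) h = ≤-limiting _ h
    lim-le (limit g) h = ≤-limiting _ h
ω^-mono (≤-cocone f {f↑} k p) =
  ≤-cocone (λ k → ω^ (f k))
    {λ k → ≤-trans (<·ω (ω^ (f k)) (ω^-pos (f k))) (ω^-mono (f↑ k))} k (ω^-mono p)
ω^-mono (≤-limiting f {f↑} h) =
  ≤-limiting (λ k → ω^ (f k))
    {λ k → ≤-trans (<·ω (ω^ (f k)) (ω^-pos (f k))) (ω^-mono (f↑ k))}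
    (λ k → ω^-mono (h k))

CtoB𝒯 : 𝒯 → Brw
CtoB𝒯 0T = zero
CtoB𝒯 (node a b) = ω^ (CtoB𝒯 a) + CtoB𝒯 b

CtoB : Cnf → Brw
CtoB (t , _) = CtoB𝒯 t

{-# OPTIONS --safe #-}
-- CtoB is strictly monotone on Cantor normal forms: if a <T c then the whole
-- normal form node a b is below ω^c, because the normal-form condition bounds
-- its tail b by ω^a · n for some n, so node a b < ω^a · (n + 2) ≤ ω^c.
-- Since <T is trichotomous and < on Brouwer trees is irreflexive, equal images
-- force equal trees, and the normal-form proofs agree because isCNF is
-- propositional.
module Submission where

open import Defs
open import Relation.Binary.PropositionalEquality using (_≡_; refl; cong)
open import Data.Nat as ℕ using (ℕ)
open import Data.Product using (Σ; _,_; proj₁; proj₂)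
open import Data.Sum using (_⊎_; inj₁; inj₂)
open import Data.Empty using (⊥; ⊥-elim)
open import Data.Unit using (⊤; tt)

-- The order ≤ has a transitivity constructor, so it cannot be inverted
-- directly; ≼ is its structurally recursive counterpart, used to refute x < x.
infix 4 _≼_

_≼_ : Brw → Brw → Set
zero    ≼ y       = ⊤
succ x  ≼ zero    = ⊥
succ x  ≼ succ y  = x ≼ y
succ x  ≼ limit f = Σ ℕ λ k → succ x ≼ f k
limit f ≼ y       = (k : ℕ) → f k ≼ y

≼-trans : ∀ x y z → x ≼ y → y ≼ z → x ≼ z
≼-trans zero      y         z         p       q       = tt
≼-trans (limit f) y         z         p       q       = λ k → ≼-trans (f k) y z (p k) q
≼-trans (succ x)  zero      z         ()      q
≼-trans (succ x)  (succ y)  zero      p       ()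
≼-trans (succ x)  (succ y)  (succ z)  p       q       = ≼-trans x y z p q
≼-trans (succ x)  (succ y)  (limit h) p       (k , q) = k , ≼-trans (succ x) (succ y) (h k) p q
≼-trans (succ x)  (limit g) z         (k , p) q       = ≼-trans (succ x) (g k) z p (q k)

≼-cocone : ∀ x f {f↑} k → x ≼ f k → x ≼ limit f {f↑}
≼-cocone zero      f k p = tt
≼-cocone (succ x)  f k p = k , p
≼-cocone (limit h) f k p = λ j → ≼-cocone (h j) f k (p j)

≤⇒≼ : ∀ {x y} → x ≤ y → x ≼ y
≤⇒≼ ≤-zero                     = tt
≤⇒≼ (≤-trans {x} {y} {z} p q)  = ≼-trans x y z (≤⇒≼ p) (≤⇒≼ q)
≤⇒≼ (≤-succ-mono p)            = ≤⇒≼ p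
≤⇒≼ (≤-cocone {x} f k p)       = ≼-cocone x f k (≤⇒≼ p)
≤⇒≼ (≤-limiting f h)           = λ k → ≤⇒≼ (h k)

<-irrefl′ : ∀ x → succ x ≼ x → ⊥
<-irrefl′ zero ()
<-irrefl′ (succ x) p = <-irrefl′ x p
<-irrefl′ (limit f {f↑}) (k , p) =
  <-irrefl′ (f k) (≼-trans (succ (f k)) (succ (limit f)) (f k) (≤⇒≼ fk<limf+1) p)
  where
  fk<limf+1 : succ (f k) ≤ succ (limit f {f↑})
  fk<limf+1 = ≤-trans (f↑ k)
                (≤-trans (≤-cocone f (ℕ.suc k) (≤-refl (f (ℕ.suc k))))
                         (≤-succ-incr (limit f)))

<-irrefl : ∀ x → x < x → ⊥
<-irrefl x p = <-irrefl′ x (≤⇒≼ p)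

≈⇒≤ : ∀ {x y} → x ≈ y → x ≤ y
≈⇒≥ : ∀ {x y} → x ≈ y → y ≤ x

≈⇒≤ {x} ≈-refl     = ≤-refl x
≈⇒≤ (≈-sym p)      = ≈⇒≥ p
≈⇒≤ (≈-trans p q)  = ≤-trans (≈⇒≤ p) (≈⇒≤ q)
≈⇒≤ (≈-succ p)     = ≤-succ-mono (≈⇒≤ p)
≈⇒≤ (bisim f g p q) = ≤-limiting f (λ k → ≤-cocone g (proj₁ (p k)) (proj₂ (p k)))

≈⇒≥ {x} ≈-refl     = ≤-refl x
≈⇒≥ (≈-sym p)      = ≈⇒≤ p
≈⇒≥ (≈-trans p q)  = ≤-trans (≈⇒≥ q) (≈⇒≥ p)
≈⇒≥ (≈-succ p)     = ≤-succ-mono (≈⇒≥ p)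
≈⇒≥ (bisim f g p q) = ≤-limiting g (λ k → ≤-cocone f (proj₁ (q k)) (proj₂ (q k)))

x+[y+z]≤[x+y]+z : ∀ x y z → x + (y + z) ≤ (x + y) + z
x+[y+z]≤[x+y]+z x y zero      = ≤-refl (x + y)
x+[y+z]≤[x+y]+z x y (succ z)  = ≤-succ-mono (x+[y+z]≤[x+y]+z x y z)
x+[y+z]≤[x+y]+z x y (limit f) =
  ≤-limiting _ (λ k → ≤-cocone _ k (x+[y+z]≤[x+y]+z x y (f k)))

x+x·ιn≤x·ι[1+n] : ∀ x n → x + x · ι n ≤ x · ι (ℕ.suc n)
x+x·ιn≤x·ι[1+n] x ℕ.zero    = x≤0+x x
x+x·ιn≤x·ι[1+n] x (ℕ.suc n) =
  ≤-trans (x+[y+z]≤[x+y]+z x (x · ι n) x) (+-mono-left x (x+x·ιn≤x·ι[1+n] x n))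

CtoB𝒯-tail-bound : ∀ {t a} → isCNF t → isCNF a → left t ≤T a →
                   Σ ℕ λ n → CtoB𝒯 t ≤ ω^ (CtoB𝒯 a) · ι n
CtoB𝒯-<-ω^       : ∀ {a b c} → isCNF (node a b) → isCNF c → a <T c →
                   CtoB𝒯 (node a b) < ω^ (CtoB𝒯 c)
CtoB𝒯-strictMono : ∀ {s t} → isCNF s → isCNF t → s <T t → CtoB𝒯 s < CtoB𝒯 t

CtoB𝒯-tail-bound cnf0 ca l = 0 , ≤-zero
CtoB𝒯-tail-bound t@(cnfnode _ _ _) ca (inj₁ a′<a) =
  1 , ≤-trans (≤-succ-incr _) (≤-trans (CtoB𝒯-<-ω^ t ca a′<a) (x≤0+x _))
CtoB𝒯-tail-bound {node a b} (cnfnode ca cb lb) _ (inj₂ refl)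
  with CtoB𝒯-tail-bound cb ca lb
... | n , b≤ω^a·n = ℕ.suc n , ≤-trans (+-mono b≤ω^a·n) (x+x·ιn≤x·ι[1+n] (ω^ (CtoB𝒯 a)) n)

CtoB𝒯-<-ω^ {a} (cnfnode ca cb lb) cc a<c with CtoB𝒯-tail-bound cb ca lb
... | n , b≤u·n =
  ≤-trans (≤-succ-mono (≤-trans (+-mono b≤u·n) (x+x·ιn≤x·ι[1+n] u n)))
    (≤-trans (<+pos _ (ω^-pos (CtoB𝒯 a)))
      (≤-trans (·-below-lim u ι (ℕ.suc (ℕ.suc n)))
        (ω^-mono (CtoB𝒯-strictMono ca cc a<c))))
  where u = ω^ (CtoB𝒯 a)

CtoB𝒯-strictMono cs (cnfnode {c} cc _ _) <₁ = ≤-trans (ω^-pos (CtoB𝒯 c)) (x≤x+y _ _)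
CtoB𝒯-strictMono cs (cnfnode cc _ _) (<₂ a<c) = ≤-trans (CtoB𝒯-<-ω^ cs cc a<c) (x≤x+y _ _)
CtoB𝒯-strictMono (cnfnode _ cb _) (cnfnode _ cd _) (<₃ b<d) = +-mono (CtoB𝒯-strictMono cb cd b<d)

<T-trichotomous : ∀ s t → (s <T t) ⊎ (s ≡ t) ⊎ (t <T s)
<T-trichotomous 0T         0T         = inj₂ (inj₁ refl)
<T-trichotomous 0T         (node _ _) = inj₁ <₁
<T-trichotomous (node _ _) 0T         = inj₂ (inj₂ <₁)
<T-trichotomous (node a b) (node c d) with <T-trichotomous a c
... | inj₁ a<c        = inj₁ (<₂ a<c)
... | inj₂ (inj₂ c<a) = inj₂ (inj₂ (<₂ c<a))
... | inj₂ (inj₁ refl) with <T-trichotomous b d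
...   | inj₁ b<d         = inj₁ (<₃ b<d)
...   | inj₂ (inj₁ refl) = inj₂ (inj₁ refl)
...   | inj₂ (inj₂ d<b)  = inj₂ (inj₂ (<₃ d<b))

<T-irrefl : ∀ {s} → s <T s → ⊥
<T-irrefl (<₂ p) = <T-irrefl p
<T-irrefl (<₃ p) = <T-irrefl p

<T-propositional : ∀ {s t} (p q : s <T t) → p ≡ q
<T-propositional <₁     <₁     = refl
<T-propositional (<₂ p) (<₂ q) = cong <₂ (<T-propositional p q)
<T-propositional (<₂ p) (<₃ q) = ⊥-elim (<T-irrefl p)
<T-propositional (<₃ p) (<₂ q) = ⊥-elim (<T-irrefl q)
<T-propositional (<₃ p) (<₃ q) = cong <₃ (<T-propositional p q)

≤T-propositional : ∀ {s t} (p q : s ≤T t) → p ≡ q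
≤T-propositional (inj₁ p)    (inj₁ q)    = cong inj₁ (<T-propositional p q)
≤T-propositional (inj₁ p)    (inj₂ refl) = ⊥-elim (<T-irrefl p)
≤T-propositional (inj₂ refl) (inj₁ q)    = ⊥-elim (<T-irrefl q)
≤T-propositional (inj₂ refl) (inj₂ refl) = refl

isCNF-propositional : ∀ {t} (p q : isCNF t) → p ≡ q
isCNF-propositional cnf0 cnf0 = refl
isCNF-propositional (cnfnode p₁ p₂ p₃) (cnfnode q₁ q₂ q₃)
  with isCNF-propositional p₁ q₁ | isCNF-propositional p₂ q₂ | ≤T-propositional p₃ q₃
... | refl | refl | refl = refl

CtoB𝒯-injective : ∀ {s t} → isCNF s → isCNF t → CtoB𝒯 s ≈ CtoB𝒯 t → s ≡ t
CtoB𝒯-injective {s} {t} cs ct e with <T-trichotomous s t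
... | inj₁ s<t        = ⊥-elim (<-irrefl _ (≤-trans (CtoB𝒯-strictMono cs ct s<t) (≈⇒≥ e)))
... | inj₂ (inj₁ s≡t) = s≡t
... | inj₂ (inj₂ t<s) = ⊥-elim (<-irrefl _ (≤-trans (CtoB𝒯-strictMono ct cs t<s) (≈⇒≤ e)))

corollary8p3 : (a b : Cnf) → CtoB a ≈ CtoB b → a ≡ b
corollary8p3 (s , cs) (t , ct) e with CtoB𝒯-injective cs ct e
... | refl = cong (s ,_) (isCNF-propositional cs ct)
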